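{- Let $\langle \eta; G\rangle$ be a labeled nominal hypergraph (NH-graph), considered up to NH-graph isomorphism, with the permutation action $\langle \eta; G\rangle \pi^g = \langle \pi\circ\eta; G\rangle$. Then its minimal support is the interface of $G$: $supp(\langle \eta; G\rangle) = img(\eta)$.
   Context: $\mathcal{N}$ is an enumerable set of names; $Perm(\mathcal{N})$ is the set of bijections $\pi:\mathcal{N}\to\mathcal{N}$. A hypergraph $G=(V_G,E_G,a_G)$ has vertices $V_G$, hyperedges $E_G$ and attachment $a_G:E_G\to V_G^\star$ (tuples of vertices). Given a set $\mathcal{E}$ of edge labels with arity $ar:\mathcal{E}\to\mathbb{N}$, a labeled hypergraph additionally has $lab:E_G\to\mathcal{E}$ with $|a_G(e)|=ar(lab(e))$. An NH-graph $\langle\eta;G\rangle$ is a labeled hypergraph $G$ without isolated vertices together with a partial injection $\eta$ from $V_G$ to $\mathcal{N}$; $img(\eta)$ is the interface. An NH-graph morphism $h:\langle\eta_1;G_1\rangle\to\langle\eta_2;G_2\rangle$ is a labeled hypergraph homomorphism $G_1\to G_2$ with $\eta_1\circ h_V=\eta_2$ ($h_V$ the vertex map); an isomorphism is such a morphism whose underlying homomorphism is an isomorphism, written $\cong$. Support: for an element $a$ of a set with a permutation action $\pi^A$, a set $X\subseteq\mathcal{N}$ supports $a$ if $a\pi^A=a$ for every permutation $\pi$ that is the identity on $X$ (here equality means $\cong$); the minimal support $supp(a)$ is the intersection of all sets supporting $a$. -}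

module Defs where

open import Data.Nat using (ℕ)
open import Data.Fin using (Fin)
open import Data.List using (List; length; map)
open import Data.List.Membership.Propositional using (_∈_)
open import Data.Maybe using (Maybe; just)
import Data.Maybe as Maybe
open import Data.Product using (Σ; ∃; _×_)
open import Function using (_∘_; _↔_; Inverse)
open import Function.Definitions using (Bijective)
open import Relation.Binary.PropositionalEquality using (_≡_)

Perm : Set
Perm = ℕ ↔ ℕ

record LHypergraph (L : Set) (ar : L → ℕ) : Set where
  field
    nV  : ℕ
    nE  : ℕ
    lab : Fin nE → L
    att : Fin nE → List (Fin nV)
    att-arity : ∀ e → length (att e) ≡ ar (lab e)
open LHypergraph public

NoIsolated : ∀ {L ar} → LHypergraph L ar → Set
NoIsolated G = ∀ (v : Fin (nV G)) → ∃ λ e → v ∈ att G e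

PMap : ℕ → Set
PMap n = Fin n → Maybe ℕ

PInjective : ∀ {n} → PMap n → Set
PInjective η = ∀ v w x → η v ≡ just x → η w ≡ just x → v ≡ w

record NHGraph (L : Set) (ar : L → ℕ) : Set where
  field
    graph    : LHypergraph L ar
    noIso    : NoIsolated graph
    η        : PMap (nV graph)
    η-inj    : PInjective η
open NHGraph public

img : ∀ {n} → PMap n → ℕ → Set
img η x = ∃ λ v → η v ≡ just x

record NHMorphism {L ar} (G₁ : LHypergraph L ar) (η₁ : PMap (nV G₁))
                         (G₂ : LHypergraph L ar) (η₂ : PMap (nV G₂)) : Set where
  field
    hV       : Fin (nV G₁) → Fin (nV G₂)
    hE       : Fin (nE G₁) → Fin (nE G₂)
    lab-pres : ∀ e → lab G₂ (hE e) ≡ lab G₁ e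
    att-pres : ∀ e → att G₂ (hE e) ≡ map hV (att G₁ e)
    η-pres   : ∀ v → η₂ (hV v) ≡ η₁ v

record NHIso {L ar} (G₁ : LHypergraph L ar) (η₁ : PMap (nV G₁))
                    (G₂ : LHypergraph L ar) (η₂ : PMap (nV G₂)) : Set where
  field
    mor   : NHMorphism G₁ η₁ G₂ η₂
    bijV  : Bijective _≡_ _≡_ (NHMorphism.hV mor)
    bijE  : Bijective _≡_ _≡_ (NHMorphism.hE mor)

act : ∀ {n} → Perm → PMap n → PMap n
act π η = Maybe.map (Inverse.to π) ∘ η

Supports : ∀ {L ar} → List ℕ → NHGraph L ar → Set
Supports X g =
  ∀ (π : Perm) → (∀ x → x ∈ X → Inverse.to π x ≡ x) →
  NHIso (graph g) (act π (η g)) (graph g) (η g)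

-- Membership in the minimal support: the intersection of all (finite)
-- supporting sets.
InSupp : ∀ {L ar} → ℕ → NHGraph L ar → Set
InSupp x g = ∀ (X : List ℕ) → Supports X g → x ∈ X

module Submission where

-- The interface is a finite set of names supporting the graph, because a permutation
-- fixing it leaves η untouched, so the identity is an isomorphism. Conversely, if a
-- support X misses an interface name x, swap x with a name y fresh for X and the
-- interface: the swap fixes X, hence yields an isomorphism, and isomorphisms preserve
-- interfaces, so y would be an interface name after all.

open import Defs
open import Data.Nat using (ℕ; suc; _≟_)
open import Data.Nat.Properties using (1+n≰n)
open import Data.List using (List; _∷_; _++_; catMaybes; tabulate)
open import Data.List.Extrema.Nat using (max; xs≤max)
open import Data.List.Membership.Propositional using (_∈_; _∉_)
open import Data.List.Membership.Propositional.Properties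
  using (∈-tabulate⁺; ∈-tabulate⁻; ∈-++⁺ˡ; ∈-++⁺ʳ)
open import Data.List.Membership.DecPropositional _≟_ using (_∈?_)
open import Data.List.Properties using (map-id)
open import Data.List.Relation.Unary.All using (lookup)
open import Data.List.Relation.Unary.Any using (here; there)
open import Data.Maybe using (just; nothing)
import Data.Maybe as Maybe
open import Data.Product using (_×_; _,_)
open import Function using (Inverse; id; _∘_)
open import Function.Bundles using (mk↔ₛ′)
import Function.Construct.Identity as Identity
open import Relation.Nullary using (yes; no; contradiction)
open import Relation.Binary.PropositionalEquality

∈-catMaybes⁺ : ∀ {A : Set} {x : A} {ms} → just x ∈ ms → x ∈ catMaybes ms
∈-catMaybes⁺ {ms = just _ ∷ _}  (here refl) = here refl
∈-catMaybes⁺ {ms = just _ ∷ _}  (there p)   = there (∈-catMaybes⁺ p)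
∈-catMaybes⁺ {ms = nothing ∷ _} (there p)   = ∈-catMaybes⁺ p

∈-catMaybes⁻ : ∀ {A : Set} {x : A} ms → x ∈ catMaybes ms → just x ∈ ms
∈-catMaybes⁻ (just _ ∷ ms)  (here refl) = here refl
∈-catMaybes⁻ (just _ ∷ ms)  (there p)   = there (∈-catMaybes⁻ ms p)
∈-catMaybes⁻ (nothing ∷ ms) p           = there (∈-catMaybes⁻ ms p)

fresh : List ℕ → ℕ
fresh xs = suc (max 0 xs)

fresh-∉ : ∀ xs → fresh xs ∉ xs
fresh-∉ xs p = 1+n≰n (lookup (xs≤max 0 xs) p)

transpose : ℕ → ℕ → ℕ → ℕ
transpose a b n with n ≟ a | n ≟ b
... | yes _ | _     = b
... | no _  | yes _ = a
... | no _  | no _  = n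

transpose-left : ∀ a b → transpose a b a ≡ b
transpose-left a b with a ≟ a
... | yes _   = refl
... | no a≢a = contradiction refl a≢a

transpose-right : ∀ a b → transpose a b b ≡ a
transpose-right a b with b ≟ a | b ≟ b
... | yes refl | _      = refl
... | no _     | yes _  = refl
... | no _     | no b≢b = contradiction refl b≢b

transpose-fix : ∀ a b n → n ≢ a → n ≢ b → transpose a b n ≡ n
transpose-fix a b n n≢a n≢b with n ≟ a | n ≟ b
... | yes n≡a | _       = contradiction n≡a n≢a
... | no _    | yes n≡b = contradiction n≡b n≢b
... | no _    | no _    = refl

transpose-involutive : ∀ a b n → transpose a b (transpose a b n) ≡ n
transpose-involutive a b n with n ≟ a | n ≟ b
... | yes refl | _        = transpose-right n b
... | no _     | yes refl = transpose-left a n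
... | no n≢a   | no n≢b   = transpose-fix a b n n≢a n≢b

transposition : ℕ → ℕ → Perm
transposition a b = mk↔ₛ′ (transpose a b) (transpose a b)
                          (transpose-involutive a b) (transpose-involutive a b)

interface : ∀ {n} → PMap n → List ℕ
interface η = catMaybes (tabulate η)

img⇒∈-interface : ∀ {n} {η : PMap n} {x} → img η x → x ∈ interface η
img⇒∈-interface {η = η} (v , ηv≡x) =
  ∈-catMaybes⁺ (subst (_∈ tabulate η) ηv≡x (∈-tabulate⁺ v))

∈-interface⇒img : ∀ {n} {η : PMap n} {x} → x ∈ interface η → img η x
∈-interface⇒img {η = η} p with ∈-tabulate⁻ (∈-catMaybes⁻ (tabulate η) p)
... | v , x≡ηv = v , sym x≡ηv

img-act : ∀ {n} (π : Perm) {η : PMap n} {x} → img η x → img (act π η) (Inverse.to π x)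
img-act π (v , ηv≡x) = v , cong (Maybe.map (Inverse.to π)) ηv≡x

act-fixing-interface : ∀ {n} (π : Perm) (η : PMap n) →
                       (∀ x → x ∈ interface η → Inverse.to π x ≡ x) → act π η ≗ η
act-fixing-interface π η fix v with η v in ηv≡
... | nothing = refl
... | just x  = cong just (fix x (img⇒∈-interface (v , ηv≡)))

≗⇒NHIso : ∀ {L ar} (G : LHypergraph L ar) {η₁ η₂ : PMap (nV G)} → η₁ ≗ η₂ → NHIso G η₁ G η₂
≗⇒NHIso G η₁≗η₂ = record
  { mor  = record
    { hV       = id
    ; hE       = id
    ; lab-pres = λ _ → refl
    ; att-pres = λ e → sym (map-id (att G e))
    ; η-pres   = λ v → sym (η₁≗η₂ v)
    }
  ; bijV = Identity.bijective _≡_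
  ; bijE = Identity.bijective _≡_
  }

NHMorphism-img : ∀ {L ar} {G₁ G₂ : LHypergraph L ar} {η₁ η₂ x} →
                 NHMorphism G₁ η₁ G₂ η₂ → img η₁ x → img η₂ x
NHMorphism-img h (v , η₁v≡x) = NHMorphism.hV h v , trans (NHMorphism.η-pres h v) η₁v≡x

interface-supports : ∀ {L ar} (g : NHGraph L ar) → Supports (interface (η g)) g
interface-supports g π fix = ≗⇒NHIso (graph g) (act-fixing-interface π (η g) fix)

InSupp⇒img : ∀ {L ar} (g : NHGraph L ar) {x} → InSupp x g → img (η g) x
InSupp⇒img g x∈supp = ∈-interface⇒img (x∈supp _ (interface-supports g))

img⇒InSupp : ∀ {L ar} (g : NHGraph L ar) {x} → img (η g) x → InSupp x g
img⇒InSupp g {x} x∈img X X-supports with x ∈? X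
... | yes x∈X = x∈X
... | no x∉X  = contradiction (img⇒∈-interface y∈img) (y∉ ∘ there ∘ ∈-++⁺ʳ X)
  where
  y  = fresh (x ∷ X ++ interface (η g))
  y∉ = fresh-∉ (x ∷ X ++ interface (η g))

  transpose-fixes-X : ∀ z → z ∈ X → transpose x y z ≡ z
  transpose-fixes-X z z∈X = transpose-fix x y z (λ { refl → x∉X z∈X })
                                                (λ { refl → y∉ (there (∈-++⁺ˡ z∈X)) })

  y∈img : img (η g) y
  y∈img = subst (img (η g)) (transpose-left x y)
            (NHMorphism-img (NHIso.mor (X-supports (transposition x y) transpose-fixes-X))
                            (img-act (transposition x y) x∈img))

lemma1 : ∀ {L : Set} {ar : L → ℕ} (g : NHGraph L ar) (x : ℕ) →
         (InSupp x g → img (η g) x) × (img (η g) x → InSupp x g)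
lemma1 g x = InSupp⇒img g , img⇒InSupp g
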